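{- Let $r,t\ge 2$ be integers. Let $G$ be an $r$-graph on $[n]$ not containing $M_t^r$ as a subgraph, and let $i,j\in[n]$ be distinct. Then: (a) $\pi_{ij}(G)$ does not contain $M_t^r$; (b) if in addition $G$ does not contain $K^r_{tr-1}$ and $\{i,j\}$ is contained in an edge of $G$, then $\pi_{ij}(G)$ does not contain $K^r_{tr-1}$.
   Context: An $r$-graph is a vertex set with a family of $r$-element subsets (edges). $M^r_t$ is the $r$-graph of $t$ pairwise disjoint edges; $K^r_p$ is the complete $r$-graph on $p$ vertices. For an $r$-graph $G$ on $[n]$ and distinct $i,j\in[n]$, let $L_G(j\setminus i)=\{f\subseteq[n]\setminus\{i,j\}: |f|=r-1,\ f\cup\{j\}\in E(G),\ f\cup\{i\}\notin E(G)\}$, and define the compression $\pi_{ij}(G)$ as the $r$-graph on $[n]$ with edge set $\big(E(G)\setminus\{f\cup\{j\}: f\in L_G(j\setminus i)\}\big)\cup\{f\cup\{i\}: f\in L_G(j\setminus i)\}$. -}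

module Defs where

open import Data.Nat using (ℕ; _*_; _∸_)
open import Data.Fin using (Fin; quotient; _≟_)
open import Data.Fin.Properties using (any?)
open import Data.Fin.Subset using (Subset; _∈_; _∉_; _∪_; ⁅_⁆; ∣_∣)
open import Data.Fin.Subset.Properties using (_∈?_)
open import Data.Vec using (tabulate)
open import Data.Product using (Σ; ∃; ∃-syntax; _×_; _,_)
open import Data.Sum using (_⊎_)
open import Relation.Nullary using (¬_; does)
open import Relation.Nullary.Decidable using (_×-dec_)
open import Relation.Binary.PropositionalEquality using (_≡_)
open import Function.Definitions using (Injective)

Hypergraph : ℕ → Set₁
Hypergraph n = Subset n → Set

IsRGraph : ℕ → {n : ℕ} → Hypergraph n → Set
IsRGraph r G = ∀ e → G e → ∣ e ∣ ≡ r

image : {m n : ℕ} → (Fin m → Fin n) → Subset m → Subset n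
image φ e = tabulate (λ y → does (any? (λ x → (x ∈? e) ×-dec (φ x ≟ y))))

_⊑_ : {m n : ℕ} → Hypergraph m → Hypergraph n → Set
_⊑_ {m} {n} H G =
  Σ (Fin m → Fin n) λ φ → Injective _≡_ _≡_ φ × (∀ e → H e → G (image φ e))

-- M^r_t : t pairwise disjoint edges of size r, on vertex set Fin (t * r);
-- the k-th edge is the block { v | quotient r v = k }.
Matching : (r t : ℕ) → Hypergraph (t * r)
Matching r t e = Σ (Fin t) λ k → ∀ v → (v ∈ e → quotient {t} r v ≡ k) × (quotient {t} r v ≡ k → v ∈ e)

Complete : (r p : ℕ) → Hypergraph p
Complete r p e = ∣ e ∣ ≡ r

Link : (r : ℕ) {n : ℕ} → Hypergraph n → (i j : Fin n) → Subset n → Set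
Link r G i j f =
  i ∉ f × j ∉ f × ∣ f ∣ ≡ r ∸ 1 × G (f ∪ ⁅ j ⁆) × ¬ G (f ∪ ⁅ i ⁆)

compress : (r : ℕ) {n : ℕ} → Hypergraph n → (i j : Fin n) → Hypergraph n
compress r G i j e =
  (G e × ¬ (∃[ f ] (Link r G i j f × e ≡ f ∪ ⁅ j ⁆)))
  ⊎ (∃[ f ] (Link r G i j f × e ≡ f ∪ ⁅ i ⁆))

module Submission where

-- Copies of M^r_t in an r-graph are the same as t pairwise disjoint edges (a packing). Compression
-- only trades old edges f ∪ {j} for new edges f ∪ {i}, and an edge through j but not i survives only
-- if its swap with i is an edge of G. So swapping i and j in a packing of π_ij(G) that uses a new
-- edge yields a packing of G, proving (a). For (b), a copy of K^r_{tr-1} in π_ij(G) that uses a new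
-- edge and meets j would, swapped, use a removed edge, which is impossible as K is symmetric; a copy
-- missing j meets the edge h ⊇ {i, j} of G in fewer than r vertices, and its ≥ (t-1)r other vertices
-- yield t - 1 edges of G disjoint from h, i.e. M^r_t ⊆ G.

open import Defs
open import Data.Empty using (⊥; ⊥-elim)
open import Data.Fin using (Fin; zero; suc; quotient; remQuot; combine; inject≤; cast; _≟_)
open import Data.Fin.Permutation.Components using (transpose; transpose-inverse)
open import Data.Fin.Properties
  using (any?; suc-injective; ¬Fin0; combine-remQuot; remQuot-combine; combine-injectiveʳ;
         inject≤-injective; cast-involutive)
open import Data.Fin.Subset using (Subset; _∈_; _∉_; _∪_; ⁅_⁆; ∣_∣; _⊆_; _-_; ∁; ⊤; inside; outside)
  renaming (⊥ to ∅)
open import Data.Fin.Subset.Properties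
  using (_∈?_; ⊆-antisym; x∈p∪q⁺; x∈p∪q⁻; x∈⁅x⁆; x∈⁅y⁆⇒x≡y; ∪-identityʳ; x∈p∧x≢y⇒x∈p-y; p─q⊆p;
         ∉⊥; ∈⊤; ∣⊥∣≡0; ∣⊤∣≡n; p⊂q⇒∣p∣<∣q∣; ∣∁p∣≡n∸∣p∣; x∈∁p⇒x∉p)
open import Data.Nat using (ℕ; zero; suc; _+_; _*_; _∸_; _≤_; _<_; s≤s)
open import Data.Nat.Properties using (∸-+-assoc; ∸-monoʳ-≤; m+n∸m≡n; module ≤-Reasoning)
open import Data.Product using (∃-syntax; _×_; _,_; proj₁; proj₂; uncurry)
open import Data.Sum using (_⊎_; inj₁; inj₂; [_,_]′)
open import Data.Vec using ([]; _∷_; tabulate; here; there)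
open import Data.Vec.Properties using (lookup∘tabulate; []=⇒lookup; lookup⇒[]=)
open import Function using (_∘_)
open import Function.Definitions using (Injective)
open import Relation.Nullary using (¬_; Dec; yes; no; does)
open import Relation.Nullary.Decidable using (_×-dec_; dec-true; ¬¬-excluded-middle)
open import Relation.Unary using (Decidable)
open import Relation.Binary.PropositionalEquality
  using (_≡_; _≢_; refl; sym; trans; cong; cong₂; subst; module ≡-Reasoning)

private
  variable
    m n : ℕ

x∈p∪⁅y⁆⁻ : {p : Subset n} {x y : Fin n} → x ∈ p ∪ ⁅ y ⁆ → x ∈ p ⊎ x ≡ y
x∈p∪⁅y⁆⁻ {p = p} {y = y} x∈ with x∈p∪q⁻ p ⁅ y ⁆ x∈
... | inj₁ x∈p = inj₁ x∈p
... | inj₂ x∈y = inj₂ (x∈⁅y⁆⇒x≡y y x∈y)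

x∈p⇒x∈p∪⁅y⁆ : {p : Subset n} {x y : Fin n} → x ∈ p → x ∈ p ∪ ⁅ y ⁆
x∈p⇒x∈p∪⁅y⁆ x∈p = x∈p∪q⁺ (inj₁ x∈p)

y∈p∪⁅y⁆ : {p : Subset n} {y : Fin n} → y ∈ p ∪ ⁅ y ⁆
y∈p∪⁅y⁆ {y = y} = x∈p∪q⁺ (inj₂ (x∈⁅x⁆ y))

∣p∪⁅x⁆∣≡1+∣p∣ : {p : Subset n} {x : Fin n} → x ∉ p → ∣ p ∪ ⁅ x ⁆ ∣ ≡ suc ∣ p ∣
∣p∪⁅x⁆∣≡1+∣p∣ {p = inside  ∷ p} {zero}  x∉p = ⊥-elim (x∉p here)
∣p∪⁅x⁆∣≡1+∣p∣ {p = outside ∷ p} {zero}  _   = cong (suc ∘ ∣_∣) (∪-identityʳ p)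
∣p∪⁅x⁆∣≡1+∣p∣ {p = inside  ∷ p} {suc x} x∉p = cong suc (∣p∪⁅x⁆∣≡1+∣p∣ (x∉p ∘ there))
∣p∪⁅x⁆∣≡1+∣p∣ {p = outside ∷ p} {suc x} x∉p = ∣p∪⁅x⁆∣≡1+∣p∣ (x∉p ∘ there)

x∉p-x : {p : Subset n} {x : Fin n} → x ∉ p - x
x∉p-x {p = _ ∷ _} {zero}  ()
x∉p-x {p = _ ∷ _} {suc x} (there x∈) = x∉p-x x∈

p-x∪⁅x⁆≡p : {p : Subset n} {x : Fin n} → x ∈ p → (p - x) ∪ ⁅ x ⁆ ≡ p
p-x∪⁅x⁆≡p {p = p} {x} x∈p = ⊆-antisym (λ y∈ → restore (x∈p∪⁅y⁆⁻ y∈)) split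
  where
  restore : ∀ {y} → y ∈ p - x ⊎ y ≡ x → y ∈ p
  restore (inj₁ y∈) = p─q⊆p p ⁅ x ⁆ y∈
  restore (inj₂ refl) = x∈p
  split : ∀ {y} → y ∈ p → y ∈ (p - x) ∪ ⁅ x ⁆
  split {y} y∈p with y ≟ x
  ... | yes refl = y∈p∪⁅y⁆
  ... | no y≢x = x∈p⇒x∈p∪⁅y⁆ (x∈p∧x≢y⇒x∈p-y y∈p y≢x)

1+∣p-x∣≡∣p∣ : {p : Subset n} {x : Fin n} → x ∈ p → suc ∣ p - x ∣ ≡ ∣ p ∣
1+∣p-x∣≡∣p∣ {p = p} x∈p = trans (sym (∣p∪⁅x⁆∣≡1+∣p∣ (x∉p-x {p = p}))) (cong ∣_∣ (p-x∪⁅x⁆≡p x∈p))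

select : {P : Fin n → Set} → Decidable P → Subset n
select P? = tabulate (does ∘ P?)

module _ {P : Fin n → Set} (P? : Decidable P) where

  ∈-select⁻ : ∀ {y} → y ∈ select P? → P y
  ∈-select⁻ {y} y∈ with P? y | trans (sym (lookup∘tabulate (does ∘ P?) y)) ([]=⇒lookup y∈)
  ... | yes Py | _ = Py

  ∈-select⁺ : ∀ {y} → P y → y ∈ select P?
  ∈-select⁺ {y} Py = lookup⇒[]= y _ (trans (lookup∘tabulate (does ∘ P?) y) (dec-true (P? y) Py))

module _ (φ : Fin m → Fin n) where

  private
    hits? : ∀ e → Decidable (λ y → ∃[ x ] (x ∈ e × φ x ≡ y))
    hits? e y = any? (λ x → (x ∈? e) ×-dec (φ x ≟ y))

  ∈-image⁻ : ∀ {e y} → y ∈ image φ e → ∃[ x ] (x ∈ e × φ x ≡ y)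
  ∈-image⁻ {e} = ∈-select⁻ (hits? e)

  ∈-image⁺ : ∀ {e x y} → x ∈ e → φ x ≡ y → y ∈ image φ e
  ∈-image⁺ {e} x∈e refl = ∈-select⁺ (hits? e) (_ , x∈e , refl)

  image-∪⁅⁆ : ∀ e x → image φ (e ∪ ⁅ x ⁆) ≡ image φ e ∪ ⁅ φ x ⁆
  image-∪⁅⁆ e x = ⊆-antisym (λ y∈ → forward (∈-image⁻ y∈)) (λ y∈ → backward (x∈p∪⁅y⁆⁻ y∈))
    where
    forward : ∀ {y} → ∃[ z ] (z ∈ e ∪ ⁅ x ⁆ × φ z ≡ y) → y ∈ image φ e ∪ ⁅ φ x ⁆
    forward (z , z∈ , refl) with x∈p∪⁅y⁆⁻ z∈
    ... | inj₁ z∈e = x∈p⇒x∈p∪⁅y⁆ (∈-image⁺ z∈e refl)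
    ... | inj₂ refl = y∈p∪⁅y⁆
    backward : ∀ {y} → y ∈ image φ e ⊎ y ≡ φ x → y ∈ image φ (e ∪ ⁅ x ⁆)
    backward (inj₁ y∈) = let (z , z∈e , φz≡y) = ∈-image⁻ y∈ in ∈-image⁺ (x∈p⇒x∈p∪⁅y⁆ z∈e) φz≡y
    backward (inj₂ refl) = ∈-image⁺ y∈p∪⁅y⁆ refl

image-cong : {φ ψ : Fin m → Fin n} → (∀ x → φ x ≡ ψ x) → ∀ e → image φ e ≡ image ψ e
image-cong {φ = φ} {ψ} φ≗ψ e = ⊆-antisym
  (λ y∈ → let (x , x∈e , φx≡y) = ∈-image⁻ φ y∈ in ∈-image⁺ ψ x∈e (trans (sym (φ≗ψ x)) φx≡y))
  (λ y∈ → let (x , x∈e , ψx≡y) = ∈-image⁻ ψ y∈ in ∈-image⁺ φ x∈e (trans (φ≗ψ x) ψx≡y))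

image-∘ : ∀ {k} (ψ : Fin m → Fin n) (φ : Fin k → Fin m) e → image (ψ ∘ φ) e ≡ image ψ (image φ e)
image-∘ ψ φ e = ⊆-antisym
  (λ y∈ → let (x , x∈e , eq) = ∈-image⁻ (ψ ∘ φ) y∈ in ∈-image⁺ ψ (∈-image⁺ φ x∈e refl) eq)
  (λ y∈ → let (z , z∈ , ψz≡y) = ∈-image⁻ ψ y∈
              (x , x∈e , φx≡z) = ∈-image⁻ φ z∈
          in ∈-image⁺ (ψ ∘ φ) x∈e (trans (cong ψ φx≡z) ψz≡y))

image-fix : (φ : Fin n → Fin n) {e : Subset n} → (∀ {x} → x ∈ e → φ x ≡ x) → image φ e ≡ e
image-fix φ {e} fix = ⊆-antisym
  (λ y∈ → let (x , x∈e , φx≡y) = ∈-image⁻ φ y∈ in subst (_∈ e) (trans (sym (fix x∈e)) φx≡y) x∈e)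
  (λ y∈ → ∈-image⁺ φ y∈ (fix y∈))

image-outside∷ : (φ : Fin (suc m) → Fin n) (e : Subset m) → image φ (outside ∷ e) ≡ image (φ ∘ suc) e
image-outside∷ φ e = ⊆-antisym
  (λ y∈ → let (x , x∈ , φx≡y) = ∈-image⁻ φ {outside ∷ e} y∈ in from-suc x x∈ φx≡y)
  (λ y∈ → let (x , x∈e , φx≡y) = ∈-image⁻ (φ ∘ suc) y∈ in ∈-image⁺ φ {outside ∷ e} (there x∈e) φx≡y)
  where
  from-suc : ∀ {y} x → x ∈ outside ∷ e → φ x ≡ y → y ∈ image (φ ∘ suc) e
  from-suc (suc x) (there x∈e) φx≡y = ∈-image⁺ (φ ∘ suc) x∈e φx≡y

∣image∣ : (φ : Fin m → Fin n) → Injective _≡_ _≡_ φ → ∀ e → ∣ image φ e ∣ ≡ ∣ e ∣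
∣image∣ {zero} {n} φ _ [] = trans (cong ∣_∣ image-empty) (∣⊥∣≡0 n)
  where
  image-empty : image φ [] ≡ ∅
  image-empty = ⊆-antisym (λ y∈ → ⊥-elim (¬Fin0 (proj₁ (∈-image⁻ φ {[]} y∈)))) (λ y∈ → ⊥-elim (∉⊥ y∈))
∣image∣ {suc m} φ φ-inj (outside ∷ e) =
  trans (cong ∣_∣ (image-outside∷ φ e)) (∣image∣ (φ ∘ suc) (suc-injective ∘ φ-inj) e)
∣image∣ {suc m} φ φ-inj (inside ∷ e) = begin
  ∣ image φ (inside ∷ e) ∣                 ≡⟨ cong (∣_∣ ∘ image φ ∘ (inside ∷_)) (sym (∪-identityʳ e)) ⟩
  ∣ image φ ((outside ∷ e) ∪ ⁅ zero ⁆) ∣   ≡⟨ cong ∣_∣ (image-∪⁅⁆ φ (outside ∷ e) zero) ⟩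
  ∣ image φ (outside ∷ e) ∪ ⁅ φ zero ⁆ ∣   ≡⟨ ∣p∪⁅x⁆∣≡1+∣p∣ φ0∉ ⟩
  suc ∣ image φ (outside ∷ e) ∣            ≡⟨ cong suc (cong ∣_∣ (image-outside∷ φ e)) ⟩
  suc ∣ image (φ ∘ suc) e ∣                ≡⟨ cong suc (∣image∣ (φ ∘ suc) (suc-injective ∘ φ-inj) e) ⟩
  suc ∣ e ∣                                ∎
  where
  open ≡-Reasoning
  φ0∉ : φ zero ∉ image φ (outside ∷ e)
  φ0∉ φ0∈ with ∈-image⁻ φ {outside ∷ e} φ0∈
  ... | suc _ , _ , φx≡φ0 with φ-inj φx≡φ0
  ... | ()

enumerate : (p : Subset m) → Fin ∣ p ∣ → Fin m
enumerate (inside  ∷ p) zero    = zero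
enumerate (inside  ∷ p) (suc k) = suc (enumerate p k)
enumerate (outside ∷ p) k       = suc (enumerate p k)

enumerate-∈ : (p : Subset m) (k : Fin ∣ p ∣) → enumerate p k ∈ p
enumerate-∈ (inside  ∷ p) zero    = here
enumerate-∈ (inside  ∷ p) (suc k) = there (enumerate-∈ p k)
enumerate-∈ (outside ∷ p) k       = there (enumerate-∈ p k)

enumerate-injective : (p : Subset m) → Injective _≡_ _≡_ (enumerate p)
enumerate-injective (inside  ∷ p) {zero}  {zero}  _  = refl
enumerate-injective (inside  ∷ p) {suc k} {suc l} eq = cong suc (enumerate-injective p (suc-injective eq))
enumerate-injective (outside ∷ p)                 eq = enumerate-injective p (suc-injective eq)

enumerate-surjective : (p : Subset m) {x : Fin m} → x ∈ p → ∃[ k ] (enumerate p k ≡ x)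
enumerate-surjective (inside  ∷ p) here       = zero , refl
enumerate-surjective (inside  ∷ p) (there x∈) =
  let (k , eq) = enumerate-surjective p x∈ in suc k , cong suc eq
enumerate-surjective (outside ∷ p) (there x∈) =
  let (k , eq) = enumerate-surjective p x∈ in k , cong suc eq

module _ (i j : Fin n) where

  transpose-matchˡ : transpose i j i ≡ j
  transpose-matchˡ with i ≟ i
  ... | yes _  = refl
  ... | no i≢i = ⊥-elim (i≢i refl)

  transpose-matchʳ : transpose i j j ≡ i
  transpose-matchʳ with j ≟ i
  ... | yes j≡i = j≡i
  ... | no _ with j ≟ j
  ...   | yes _  = refl
  ...   | no j≢j = ⊥-elim (j≢j refl)

  transpose-fix : ∀ {x} → x ≢ i → x ≢ j → transpose i j x ≡ x
  transpose-fix {x} x≢i x≢j with x ≟ i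
  ... | yes x≡i = ⊥-elim (x≢i x≡i)
  ... | no _ with x ≟ j
  ...   | yes x≡j = ⊥-elim (x≢j x≡j)
  ...   | no _    = refl

  transpose-injective : Injective _≡_ _≡_ (transpose i j)
  transpose-injective {x} {y} eq = begin
    x                               ≡⟨ transpose-inverse j i ⟨
    transpose j i (transpose i j x) ≡⟨ cong (transpose j i) eq ⟩
    transpose j i (transpose i j y) ≡⟨ transpose-inverse j i ⟩
    y                               ∎
    where open ≡-Reasoning

  image-transpose-fix : ∀ {e} → i ∉ e → j ∉ e → image (transpose i j) e ≡ e
  image-transpose-fix {e} i∉e j∉e =
    image-fix (transpose i j) λ x∈e → transpose-fix (λ { refl → i∉e x∈e }) (λ { refl → j∉e x∈e })

  image-transpose-∪⁅ˡ⁆ : ∀ {f} → i ∉ f → j ∉ f → image (transpose i j) (f ∪ ⁅ i ⁆) ≡ f ∪ ⁅ j ⁆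
  image-transpose-∪⁅ˡ⁆ {f} i∉f j∉f = begin
    image (transpose i j) (f ∪ ⁅ i ⁆)                 ≡⟨ image-∪⁅⁆ (transpose i j) f i ⟩
    image (transpose i j) f ∪ ⁅ transpose i j i ⁆     ≡⟨ cong₂ _∪_ (image-transpose-fix i∉f j∉f)
                                                               (cong ⁅_⁆ transpose-matchˡ) ⟩
    f ∪ ⁅ j ⁆                                         ∎
    where open ≡-Reasoning

  image-transpose-∪⁅ʳ⁆ : ∀ {f} → i ∉ f → j ∉ f → image (transpose i j) (f ∪ ⁅ j ⁆) ≡ f ∪ ⁅ i ⁆
  image-transpose-∪⁅ʳ⁆ {f} i∉f j∉f = begin
    image (transpose i j) (f ∪ ⁅ j ⁆)                 ≡⟨ image-∪⁅⁆ (transpose i j) f j ⟩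
    image (transpose i j) f ∪ ⁅ transpose i j j ⁆     ≡⟨ cong₂ _∪_ (image-transpose-fix i∉f j∉f)
                                                               (cong ⁅_⁆ transpose-matchʳ) ⟩
    f ∪ ⁅ i ⁆                                         ∎
    where open ≡-Reasoning

transpose-natural : (φ : Fin m → Fin n) → Injective _≡_ _≡_ φ →
  ∀ x y z → φ (transpose x y z) ≡ transpose (φ x) (φ y) (φ z)
transpose-natural φ φ-inj x y z with z ≟ x
... | yes refl = sym (transpose-matchˡ (φ z) (φ y))
... | no z≢x with z ≟ y
...   | yes refl = sym (transpose-matchʳ (φ x) (φ z))
...   | no z≢y   = sym (transpose-fix (φ x) (φ y) (z≢x ∘ φ-inj) (z≢y ∘ φ-inj))

PairwiseDisjoint : {t : ℕ} → (Fin t → Subset n) → Set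
PairwiseDisjoint E = ∀ {k l y} → y ∈ E k → y ∈ E l → k ≡ l

record Packing (G : Hypergraph n) (t : ℕ) : Set where
  field
    edge     : Fin t → Subset n
    isEdge   : ∀ k → G (edge k)
    disjoint : PairwiseDisjoint edge

image-pairwiseDisjoint : ∀ {t} (φ : Fin m → Fin n) → Injective _≡_ _≡_ φ →
  {E : Fin t → Subset m} → PairwiseDisjoint E → PairwiseDisjoint (image φ ∘ E)
image-pairwiseDisjoint φ φ-inj E-disjoint y∈φEk y∈φEl
  with ∈-image⁻ φ y∈φEk | ∈-image⁻ φ y∈φEl
... | x , x∈Ek , φx≡y | x′ , x′∈El , φx′≡y =
  E-disjoint x∈Ek (subst (_∈ _) (φ-inj (trans φx′≡y (sym φx≡y))) x′∈El)

module _ (r : ℕ) {t : ℕ} where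

  block : Fin t → Subset (t * r)
  block k = select (λ v → quotient {t} r v ≟ k)

  ∈-block⁻ : ∀ {k v} → v ∈ block k → quotient {t} r v ≡ k
  ∈-block⁻ {k} = ∈-select⁻ (λ v → quotient {t} r v ≟ k)

  ∈-block⁺ : ∀ {k v} → quotient {t} r v ≡ k → v ∈ block k
  ∈-block⁺ {k} = ∈-select⁺ (λ v → quotient {t} r v ≟ k)

  block-disjoint : PairwiseDisjoint block
  block-disjoint v∈k v∈l = trans (sym (∈-block⁻ v∈k)) (∈-block⁻ v∈l)

  matching-block : ∀ k → Matching r t (block k)
  matching-block k = k , λ v → ∈-block⁻ , ∈-block⁺

  block-matching : ∀ {e} ((k , e≡block) : Matching r t e) → e ≡ block k
  block-matching (k , e≡block) =
    ⊆-antisym (λ {v} v∈ → ∈-block⁺ (proj₁ (e≡block v) v∈)) (λ {v} v∈ → proj₂ (e≡block v) (∈-block⁻ v∈))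

  remQuot-injective : Injective _≡_ _≡_ (remQuot {t} r)
  remQuot-injective {v} {w} eq = begin
    v                                   ≡⟨ combine-remQuot {t} r v ⟨
    uncurry combine (remQuot {t} r v)   ≡⟨ cong (uncurry combine) eq ⟩
    uncurry combine (remQuot {t} r w)   ≡⟨ combine-remQuot {t} r w ⟩
    w                                   ∎
    where open ≡-Reasoning

block≡image-combine : ∀ r {t} (k : Fin t) → block r k ≡ image (combine {n = r} k) ⊤
block≡image-combine r {t} k = ⊆-antisym
  (λ {v} v∈ → ∈-image⁺ (combine k) ∈⊤ (combine-remainder v (∈-block⁻ r {t} v∈)))
  (λ {v} v∈ → let (ρ , _ , combine≡v) = ∈-image⁻ (combine k) v∈ in
    ∈-block⁺ r {t} (subst (λ w → quotient {t} r w ≡ k) combine≡v (cong proj₁ (remQuot-combine k ρ))))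
  where
  combine-remainder : ∀ v → quotient {t} r v ≡ k → combine k (proj₂ (remQuot {t} r v)) ≡ v
  combine-remainder v refl = combine-remQuot {t} r v

∣block∣ : ∀ r {t} (k : Fin t) → ∣ block r k ∣ ≡ r
∣block∣ r k = begin
  ∣ block r k ∣                  ≡⟨ cong ∣_∣ (block≡image-combine r k) ⟩
  ∣ image (combine {n = r} k) ⊤ ∣ ≡⟨ ∣image∣ (combine k) (λ {ρ} {σ} → combine-injectiveʳ k ρ k σ) ⊤ ⟩
  ∣ ⊤ {r} ∣                      ≡⟨ ∣⊤∣≡n r ⟩
  r                              ∎
  where open ≡-Reasoning

⊑⇒Packing : ∀ {r t} {G : Hypergraph n} → Matching r t ⊑ G → Packing G t
⊑⇒Packing {r = r} (φ , φ-inj , φ-hom) = record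
  { edge     = image φ ∘ block r
  ; isEdge   = λ k → φ-hom (block r k) (matching-block r k)
  ; disjoint = image-pairwiseDisjoint φ φ-inj (block-disjoint r)
  }

Packing⇒⊑ : ∀ {r t} {G : Hypergraph n} (P : Packing G t) →
  (∀ k → ∣ Packing.edge P k ∣ ≡ r) → Matching r t ⊑ G
Packing⇒⊑ {n} {r} {t} {G} P ∣edge∣≡r = ψ , ψ-injective , λ e e∈M → subst G (sym (image-ψ e∈M)) (isEdge _)
  where
  open Packing P
  vertex : Fin t → Fin r → Fin n
  vertex k ρ = enumerate (edge k) (cast (sym (∣edge∣≡r k)) ρ)

  vertex-injective : ∀ {k l ρ σ} → vertex k ρ ≡ vertex l σ → (k , ρ) ≡ (l , σ)
  vertex-injective {k} {l} {ρ} {σ} eq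
    with disjoint (enumerate-∈ (edge k) _) (subst (_∈ edge l) (sym eq) (enumerate-∈ (edge l) _))
  ... | refl = cong (k ,_) (begin
    ρ                                             ≡⟨ cast-involutive (∣edge∣≡r k) (sym (∣edge∣≡r k)) ρ ⟨
    cast (∣edge∣≡r k) (cast (sym (∣edge∣≡r k)) ρ) ≡⟨ cong (cast (∣edge∣≡r k)) (enumerate-injective (edge k) eq) ⟩
    cast (∣edge∣≡r k) (cast (sym (∣edge∣≡r k)) σ) ≡⟨ cast-involutive (∣edge∣≡r k) (sym (∣edge∣≡r k)) σ ⟩
    σ                                             ∎)
    where open ≡-Reasoning

  ψ : Fin (t * r) → Fin n
  ψ = uncurry vertex ∘ remQuot r

  ψ-injective : Injective _≡_ _≡_ ψ
  ψ-injective = remQuot-injective r ∘ vertex-injective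

  ψ-combine : ∀ k ρ → ψ (combine k ρ) ≡ vertex k ρ
  ψ-combine k ρ = cong (uncurry vertex) (remQuot-combine k ρ)

  image-ψ : ∀ {e} (e∈M : Matching r t e) → image ψ e ≡ edge (proj₁ e∈M)
  image-ψ e∈M@(k , _) rewrite block-matching r e∈M = ⊆-antisym image⊆edge edge⊆image
    where
    image⊆edge : image ψ (block r k) ⊆ edge k
    image⊆edge y∈ = let (v , v∈ , ψv≡y) = ∈-image⁻ ψ y∈ in
      subst (_∈ edge k) ψv≡y (subst (λ l → ψ v ∈ edge l) (∈-block⁻ r v∈) (enumerate-∈ _ _))

    edge⊆image : edge k ⊆ image ψ (block r k)
    edge⊆image y∈ = let (κ , κ-th≡y) = enumerate-surjective (edge k) y∈ ; ρ = cast (∣edge∣≡r k) κ in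
      ∈-image⁺ ψ (∈-block⁺ r (cong proj₁ (remQuot-combine k ρ)))
        (trans (ψ-combine k ρ)
        (trans (cong (enumerate (edge k)) (cast-involutive (sym (∣edge∣≡r k)) (∣edge∣≡r k) κ)) κ-th≡y))

extend : ∀ {s} {G : Hypergraph n} (P : Packing G s) {h : Subset n} → G h →
  (∀ k {y} → y ∈ h → y ∉ Packing.edge P k) → Packing G (suc s)
extend {n} {s} {G} P {h} h∈G h-apart = record { edge = edge′ ; isEdge = isEdge′ ; disjoint = disjoint′ }
  where
  open Packing P
  edge′ : Fin (suc s) → Subset n
  edge′ zero    = h
  edge′ (suc k) = edge k
  isEdge′ : ∀ k → G (edge′ k)
  isEdge′ zero    = h∈G
  isEdge′ (suc k) = isEdge k
  disjoint′ : PairwiseDisjoint edge′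
  disjoint′ {zero}  {zero}  _   _   = refl
  disjoint′ {zero}  {suc l} y∈h y∈l = ⊥-elim (h-apart l y∈h y∈l)
  disjoint′ {suc k} {zero}  y∈k y∈h = ⊥-elim (h-apart k y∈h y∈k)
  disjoint′ {suc k} {suc l} y∈k y∈l = cong suc (disjoint y∈k y∈l)

preimage : (Fin m → Fin n) → Subset n → Subset m
preimage φ p = select (λ x → φ x ∈? p)

∣preimage∣<∣p∣ : (φ : Fin m → Fin n) → Injective _≡_ _≡_ φ → ∀ {p y} → y ∈ p → (∀ x → φ x ≢ y) →
  ∣ preimage φ p ∣ < ∣ p ∣
∣preimage∣<∣p∣ φ φ-inj {p} {y} y∈p y∉range =
  subst (_< ∣ p ∣) (∣image∣ φ φ-inj (preimage φ p)) (p⊂q⇒∣p∣<∣q∣ (image⊆p , y , y∈p , y∉image))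
  where
  image⊆p : image φ (preimage φ p) ⊆ p
  image⊆p z∈ = let (x , x∈ , φx≡z) = ∈-image⁻ φ z∈ in subst (_∈ p) φx≡z (∈-select⁻ (λ x → φ x ∈? p) x∈)
  y∉image : y ∉ image φ (preimage φ p)
  y∉image y∈ = let (x , _ , φx≡y) = ∈-image⁻ φ y∈ in y∉range x φx≡y

s*r≤[1+s]*r∸1∸a : ∀ r s {a} → a < r → s * r ≤ (suc s * r ∸ 1) ∸ a
s*r≤[1+s]*r∸1∸a r s {a} a<r = begin
  s * r                  ≡⟨ m+n∸m≡n r (s * r) ⟨
  (r + s * r) ∸ r        ≤⟨ ∸-monoʳ-≤ (r + s * r) a<r ⟩
  (r + s * r) ∸ (1 + a)  ≡⟨ ∸-+-assoc (r + s * r) 1 a ⟨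
  (r + s * r ∸ 1) ∸ a    ∎
  where open ≤-Reasoning

Complete-transpose : ∀ r p x y {e} → Complete r p e → Complete r p (image (transpose x y) e)
Complete-transpose r p x y {e} ∣e∣≡r = trans (∣image∣ (transpose x y) (transpose-injective x y) e) ∣e∣≡r

module Compression (r : ℕ) {n : ℕ} (G : Hypergraph n) (G-uniform : IsRGraph r G)
                   (i j : Fin n) (i≢j : i ≢ j) where

  π : Hypergraph n
  π = compress r G i j

  τ : Subset n → Subset n
  τ = image (transpose i j)

  j∉f∪⁅i⁆ : ∀ {f} → j ∉ f → j ∉ f ∪ ⁅ i ⁆
  j∉f∪⁅i⁆ j∉f j∈ with x∈p∪⁅y⁆⁻ j∈
  ... | inj₁ j∈f = j∉f j∈f
  ... | inj₂ j≡i = i≢j (sym j≡i)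

  compress-avoiding : ∀ {e} → π e → i ∉ e → G e
  compress-avoiding (inj₁ (e∈G , _))         _   = e∈G
  compress-avoiding (inj₂ (_ , _ , refl)) i∉e = ⊥-elim (i∉e y∈p∪⁅y⁆)

  compress-new : ∀ {e} → π e → ¬ G e → ∃[ f ] (Link r G i j f × e ≡ f ∪ ⁅ i ⁆)
  compress-new (inj₁ (e∈G , _)) e∉G = ⊥-elim (e∉G e∈G)
  compress-new (inj₂ new)       _   = new

  compress-removed : ∀ {f} → Link r G i j f → ¬ π (f ∪ ⁅ j ⁆)
  compress-removed link (inj₁ (_ , ¬removed)) = ¬removed (_ , link , refl)
  compress-removed link (inj₂ (f′ , (_ , j∉f′ , _) , f∪j≡f′∪i)) =
    j∉f∪⁅i⁆ j∉f′ (subst (j ∈_) f∪j≡f′∪i y∈p∪⁅y⁆)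

  swap-survivor : ∀ {e} → π e → i ∉ e → j ∈ e → ¬ ¬ G (τ e)
  swap-survivor {e} e∈π i∉e j∈e ¬τe∈G = compress-removed link (subst π e≡g∪j e∈π)
    where
    g = e - j
    e≡g∪j : e ≡ g ∪ ⁅ j ⁆
    e≡g∪j = sym (p-x∪⁅x⁆≡p j∈e)
    i∉g : i ∉ g
    i∉g = i∉e ∘ p─q⊆p e ⁅ j ⁆
    j∉g : j ∉ g
    j∉g = x∉p-x {p = e}
    link : Link r G i j g
    link = i∉g , j∉g
         , cong (_∸ 1) (trans (1+∣p-x∣≡∣p∣ j∈e) (G-uniform e (compress-avoiding e∈π i∉e)))
         , subst G e≡g∪j (compress-avoiding e∈π i∉e)
         , ¬τe∈G ∘ subst G (trans (sym (image-transpose-∪⁅ʳ⁆ i j i∉g j∉g)) (cong τ (sym e≡g∪j)))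

  module _ {t} (P : Packing π t) where
    open Packing P

    Packing-if-i-edge∈G : (∀ k → i ∈ edge k → G (edge k)) → Packing G t
    Packing-if-i-edge∈G i-edge∈G = record { edge = edge ; isEdge = isEdge′ ; disjoint = disjoint }
      where
      isEdge′ : ∀ k → G (edge k)
      isEdge′ k with i ∈? edge k
      ... | yes i∈k = i-edge∈G k i∈k
      ... | no  i∉k = compress-avoiding (isEdge k) i∉k

    Packing-swapped : (∀ k → i ∈ edge k ⊎ j ∈ edge k → G (τ (edge k))) → Packing G t
    Packing-swapped swapped∈G = record
      { edge     = τ ∘ edge
      ; isEdge   = isEdge′
      ; disjoint = image-pairwiseDisjoint (transpose i j) (transpose-injective i j) disjoint
      }
      where
      isEdge′ : ∀ k → G (τ (edge k))
      isEdge′ k with i ∈? edge k | j ∈? edge k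
      ... | yes i∈k | _       = swapped∈G k (inj₁ i∈k)
      ... | no  _   | yes j∈k = swapped∈G k (inj₂ j∈k)
      ... | no  i∉k | no  j∉k =
        subst G (sym (image-transpose-fix i j i∉k j∉k)) (compress-avoiding (isEdge k) i∉k)

    -- The new edge f ∪ {i} swaps back to the old edge f ∪ {j}, and the edge through j (if any)
    -- swaps to an edge by swap-survivor.
    new-i-edge⇒Packing : ∀ {kᵢ} → i ∈ edge kᵢ → ¬ G (edge kᵢ) → ¬ ¬ Packing G t
    new-i-edge⇒Packing {kᵢ} i∈kᵢ kᵢ∉G no-packing with compress-new (isEdge kᵢ) kᵢ∉G
    ... | f , (i∉f , j∉f , _ , f∪j∈G , _) , kᵢ≡f∪i = j-case (any? (λ k → j ∈? edge k))
      where
      i-side : ∀ k → i ∈ edge k → G (τ (edge k))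
      i-side k i∈k = subst (G ∘ τ ∘ edge) (disjoint i∈kᵢ i∈k)
        (subst G (sym (trans (cong τ kᵢ≡f∪i) (image-transpose-∪⁅ˡ⁆ i j i∉f j∉f))) f∪j∈G)

      swapped : (∀ k → j ∈ edge k → G (τ (edge k))) → Packing G t
      swapped j-side = Packing-swapped λ k → [ i-side k , j-side k ]′

      j-case : Dec (∃[ k ] j ∈ edge k) → ⊥
      j-case (no ∄k) = no-packing (swapped λ k j∈k → ⊥-elim (∄k (k , j∈k)))
      j-case (yes (kⱼ , j∈kⱼ)) = swap-survivor (isEdge kⱼ) i∉kⱼ j∈kⱼ λ τkⱼ∈G →
        no-packing (swapped λ k j∈k → subst (G ∘ τ ∘ edge) (disjoint j∈kⱼ j∈k) τkⱼ∈G)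
        where
        i∉kⱼ : i ∉ edge kⱼ
        i∉kⱼ i∈kⱼ = j∉f∪⁅i⁆ j∉f
          (subst (j ∈_) kᵢ≡f∪i (subst (λ k → j ∈ edge k) (disjoint i∈kⱼ i∈kᵢ) j∈kⱼ))

  compress-¬Packing : ∀ {t} → ¬ Packing G t → ¬ Packing π t
  compress-¬Packing no-packing P with any? (λ k → i ∈? Packing.edge P k)
  ... | no ∄k = no-packing (Packing-if-i-edge∈G P λ k i∈k → ⊥-elim (∄k (k , i∈k)))
  ... | yes (kᵢ , i∈kᵢ) = ¬¬-excluded-middle λ where
    (yes kᵢ∈G) → no-packing (Packing-if-i-edge∈G P λ k i∈k →
                   subst (G ∘ Packing.edge P) (Packing.disjoint P i∈kᵢ i∈k) kᵢ∈G)
    (no kᵢ∉G)  → new-i-edge⇒Packing P i∈kᵢ kᵢ∉G no-packing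

  -- A copy of H in π using a new edge f ∪ {i} and meeting j would, after swapping the preimages
  -- of i and j, use the removed edge f ∪ {j}.
  ⊑-through-j : ∀ {m} {H : Hypergraph m} → (∀ x y {e} → H e → H (image (transpose x y) e)) →
    ((φ , _) : H ⊑ π) → ∃[ y ] φ y ≡ j → H ⊑ G
  ⊑-through-j {H = H} H-closed (φ , φ-inj , φ-hom) (y , φy≡j) =
    φ , φ-inj , λ e e∈H → old-edge e∈H (φ-hom e e∈H)
    where
    old-edge : ∀ {e} → H e → π (image φ e) → G (image φ e)
    old-edge _ (inj₁ (φe∈G , _)) = φe∈G
    old-edge {e} e∈H (inj₂ (f , link@(i∉f , j∉f , _) , φe≡f∪i)) =
      ⊥-elim (compress-removed link (subst π φe′≡f∪j (φ-hom e′ (H-closed x y e∈H))))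
      where
      open ≡-Reasoning
      i∈φe : i ∈ image φ e
      i∈φe = subst (i ∈_) (sym φe≡f∪i) y∈p∪⁅y⁆
      x = proj₁ (∈-image⁻ φ i∈φe)
      φx≡i : φ x ≡ i
      φx≡i = proj₂ (proj₂ (∈-image⁻ φ i∈φe))
      e′ = image (transpose x y) e
      φe′≡f∪j : image φ e′ ≡ f ∪ ⁅ j ⁆
      φe′≡f∪j = begin
        image φ (image (transpose x y) e)  ≡⟨ image-∘ φ (transpose x y) e ⟨
        image (φ ∘ transpose x y) e        ≡⟨ image-cong (λ z → trans (transpose-natural φ φ-inj x y z)
                                                  (cong₂ (λ a b → transpose a b (φ z)) φx≡i φy≡j)) e ⟩
        image (transpose i j ∘ φ) e        ≡⟨ image-∘ (transpose i j) φ e ⟩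
        τ (image φ e)                      ≡⟨ cong τ φe≡f∪i ⟩
        τ (f ∪ ⁅ i ⁆)                      ≡⟨ image-transpose-∪⁅ˡ⁆ i j i∉f j∉f ⟩
        f ∪ ⁅ j ⁆                          ∎

  -- A K^r_{tr-1} missing j meets an edge h ∋ i, j in fewer than r vertices, so the rest of it
  -- holds t - 1 disjoint r-sets; they avoid i, hence are edges of G disjoint from h.
  K-missing-j⇒Packing : ∀ {s h} → G h → i ∈ h → j ∈ h →
    ((φ , _) : Complete r (suc s * r ∸ 1) ⊑ π) → (∀ x → φ x ≢ j) → Packing G (suc s)
  K-missing-j⇒Packing {s} {h} h∈G i∈h j∈h (φ , φ-inj , φ-hom) j∉range = extend rest h∈G rest-apart
    where
    A = preimage φ h

    room : s * r ≤ ∣ ∁ A ∣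
    room = subst (s * r ≤_) (sym (∣∁p∣≡n∸∣p∣ A))
      (s*r≤[1+s]*r∸1∸a r s (subst (∣ A ∣ <_) (G-uniform h h∈G) (∣preimage∣<∣p∣ φ φ-inj j∈h j∉range)))

    ξ : Fin (s * r) → Fin (suc s * r ∸ 1)
    ξ z = enumerate (∁ A) (inject≤ z room)

    ξ-injective : Injective _≡_ _≡_ ξ
    ξ-injective eq = inject≤-injective room room _ _ (enumerate-injective (∁ A) eq)

    φξ∉h : ∀ z → φ (ξ z) ∉ h
    φξ∉h z φξz∈h = x∈∁p⇒x∉p (enumerate-∈ (∁ A) _) (∈-select⁺ (λ x → φ x ∈? h) φξz∈h)

    chunk : Fin s → Subset (suc s * r ∸ 1)
    chunk k = image ξ (block r k)

    rest-apart : ∀ k {y} → y ∈ h → y ∉ image φ (chunk k)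
    rest-apart k y∈h y∈ =
      let (x , x∈chunk , φx≡y) = ∈-image⁻ φ y∈
          (z , _ , ξz≡x)       = ∈-image⁻ ξ x∈chunk
      in φξ∉h z (subst (_∈ h) (sym (trans (cong φ ξz≡x) φx≡y)) y∈h)

    rest : Packing G s
    rest = record
      { edge     = image φ ∘ chunk
      ; isEdge   = λ k → compress-avoiding
                       (φ-hom (chunk k) (trans (∣image∣ ξ ξ-injective _) (∣block∣ r k)))
                       (rest-apart k i∈h)
      ; disjoint = image-pairwiseDisjoint φ φ-inj (image-pairwiseDisjoint ξ ξ-injective (block-disjoint r))
      }

lemma2p3 : (r t n : ℕ) → 2 ≤ r → 2 ≤ t → (G : Hypergraph n) → IsRGraph r G →
    ¬ (Matching r t ⊑ G) → (i j : Fin n) → i ≢ j →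
    ¬ (Matching r t ⊑ compress r G i j)
    × (¬ (Complete r (t * r ∸ 1) ⊑ G) → (∃[ e ] (G e × i ∈ e × j ∈ e)) →
    ¬ (Complete r (t * r ∸ 1) ⊑ compress r G i j))
lemma2p3 r (suc s) n _ (s≤s _) G G-uniform no-matching i j i≢j = part-a , part-b
  where
  open Compression r G G-uniform i j i≢j

  no-packing : ¬ Packing G (suc s)
  no-packing P = no-matching (Packing⇒⊑ P λ k → G-uniform _ (Packing.isEdge P k))

  part-a : ¬ (Matching r (suc s) ⊑ π)
  part-a = compress-¬Packing no-packing ∘ ⊑⇒Packing

  part-b : ¬ (Complete r (suc s * r ∸ 1) ⊑ G) → ∃[ h ] (G h × i ∈ h × j ∈ h) →
    ¬ (Complete r (suc s * r ∸ 1) ⊑ π)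
  part-b no-K (h , h∈G , i∈h , j∈h) K⊑π@(φ , _) with any? (λ x → φ x ≟ j)
  ... | yes j∈range = no-K (⊑-through-j (Complete-transpose r _) K⊑π j∈range)
  ... | no  j∉range = no-packing (K-missing-j⇒Packing h∈G i∈h j∈h K⊑π λ x φx≡j → j∉range (x , φx≡j))
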